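{- Let $T$ be a tangle of order $k$ in a digraph $G$ and let $(A_1,B_1),(A_2,B_2)\in T$. If $(A_1\cup A_2,B_1\cap B_2)$ is a directed separation of $G$ of order less than $k$, then $(A_1\cup A_2,B_1\cap B_2)\in T$.
   Context: A directed separation of $G$ is a pair $(A,B)$ of subgraphs of $G$ with $V(A)\cup V(B)=V(G)$ such that either no edge has tail in $V(A)\setminus V(B)$ and head in $V(B)\setminus V(A)$, or no edge has tail in $V(B)\setminus V(A)$ and head in $V(A)\setminus V(B)$; its order is $|V(A)\cap V(B)|$. A tangle of order $k$ in $G$ is a set $T$ of directed separations of order $<k$ such that (i) for every directed separation $(A,B)$ of $G$ of order $<k$, $(A,B)\in T$ or $(B,A)\in T$, and (ii) for all (not necessarily distinct) $(A_1,B_1),(A_2,B_2),(A_3,B_3)\in T$, $V(A_1)\cup V(A_2)\cup V(A_3)\neq V(G)$. Unions and intersections of subgraphs are taken in the usual sense. -}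

module Defs where

open import Data.Nat using (ℕ; _<_)
open import Data.Fin using (Fin)
open import Data.Fin.Subset using (Subset; _∈_; _∉_; _∪_; _∩_; ∣_∣; ⊤)
open import Data.Product using (_×_)
open import Data.Sum using (_⊎_)
open import Relation.Nullary using (¬_)
open import Relation.Binary.PropositionalEquality using (_≡_; _≢_)

record Digraph : Set where
  field
    n    : ℕ
    m    : ℕ
    tail : Fin m → Fin n
    head : Fin m → Fin n
open Digraph public

record Sub (G : Digraph) : Set where
  constructor sub
  field
    V : Subset (n G)
    E : Subset (m G)
open Sub public

IsSubgraph : (G : Digraph) → Sub G → Set
IsSubgraph G A = ∀ e → e ∈ E A → (tail G e ∈ V A) × (head G e ∈ V A)

_∪ₛ_ : {G : Digraph} → Sub G → Sub G → Sub G
A ∪ₛ B = sub (V A ∪ V B) (E A ∪ E B)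

_∩ₛ_ : {G : Digraph} → Sub G → Sub G → Sub G
A ∩ₛ B = sub (V A ∩ V B) (E A ∩ E B)

NoEdgeFromTo : (G : Digraph) → Sub G → Sub G → Set
NoEdgeFromTo G A B =
  ∀ e → ¬ ((tail G e ∈ V A) × (tail G e ∉ V B) × (head G e ∈ V B) × (head G e ∉ V A))

record IsDirSep (G : Digraph) (A B : Sub G) : Set where
  field
    subA  : IsSubgraph G A
    subB  : IsSubgraph G B
    cover : V A ∪ V B ≡ ⊤
    dir   : NoEdgeFromTo G A B ⊎ NoEdgeFromTo G B A

order : {G : Digraph} → Sub G → Sub G → ℕ
order A B = ∣ V A ∩ V B ∣

record IsTangle (G : Digraph) (k : ℕ) (T : Sub G → Sub G → Set) : Set where
  field
    members : ∀ A B → T A B → IsDirSep G A B × (order A B < k)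
    orient  : ∀ A B → IsDirSep G A B → order A B < k → T A B ⊎ T B A
    cover3  : ∀ A₁ B₁ A₂ B₂ A₃ B₃ → T A₁ B₁ → T A₂ B₂ → T A₃ B₃ →
              (V A₁ ∪ V A₂) ∪ V A₃ ≢ ⊤

module Submission where

open import Defs
open import Data.Nat using (ℕ; _<_)
open import Data.Fin.Subset using (_∪_; ⊤)
open import Data.Sum using (inj₁; inj₂)
open import Data.Empty using (⊥-elim)
open import Relation.Binary.PropositionalEquality using (_≡_)

-- If (B, A) were in T, it would cover G together with (A₁, B₁) and (A₂, B₂).
tangle-contains-if-covered :
  {G : Digraph} {k : ℕ} {T : Sub G → Sub G → Set} → IsTangle G k T →
  {A₁ B₁ A₂ B₂ : Sub G} → T A₁ B₁ → T A₂ B₂ →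
  {A B : Sub G} → IsDirSep G A B → order A B < k →
  (V A₁ ∪ V A₂) ∪ V B ≡ ⊤ → T A B
tangle-contains-if-covered tangle {A₁} {B₁} {A₂} {B₂} t₁ t₂ {A} {B} sep small covered
  with IsTangle.orient tangle A B sep small
... | inj₁ tAB = tAB
... | inj₂ tBA = ⊥-elim (IsTangle.cover3 tangle A₁ B₁ A₂ B₂ B A t₁ t₂ tBA covered)

lemma4p2 : (G : Digraph) (k : ℕ) (T : Sub G → Sub G → Set) → IsTangle G k T →
    (A₁ B₁ A₂ B₂ : Sub G) → T A₁ B₁ → T A₂ B₂ →
    IsDirSep G (A₁ ∪ₛ A₂) (B₁ ∩ₛ B₂) → order (A₁ ∪ₛ A₂) (B₁ ∩ₛ B₂) < k →
    T (A₁ ∪ₛ A₂) (B₁ ∩ₛ B₂)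
lemma4p2 G k T tangle A₁ B₁ A₂ B₂ t₁ t₂ sep small =
  tangle-contains-if-covered tangle t₁ t₂ sep small (IsDirSep.cover sep)
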